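{- Let $\lambda$ be a partition with $|\lambda| = k$. Then for all $n \in \mathbb{N}$ (including $n=0$), \[ \frac{1}{\# \mathcal{OT}(\lambda,k+2n)\cdot(2n+k+1)} \sum_{T \in \mathcal{OT}(\lambda,k+2n)} \mathrm{wt}(T) = \frac{n}{3} + \frac{k}{2}.\]
   Context: Young's lattice is the poset of all integer partitions ordered by inclusion of Young diagrams; write $\mu \lessdot \lambda$ if $\lambda$ is obtained from $\mu$ by adding one box. $|\lambda|$ denotes the size (number of boxes) of $\lambda$. An oscillating tableau of shape $\lambda$ and length $l$ is a sequence of partitions $T=(\lambda^{0},\lambda^{1},\ldots,\lambda^{l})$ with $\lambda^0=\emptyset$, $\lambda^l=\lambda$, and for each $1\le i\le l$ either $\lambda^{i-1}\lessdot\lambda^{i}$ or $\lambda^{i}\lessdot\lambda^{i-1}$. $\mathcal{OT}(\lambda,l)$ denotes the set of such tableaux. The weight of $T=(\lambda^{0},\ldots,\lambda^{l})$ is $\mathrm{wt}(T) := \sum_{i=0}^{l} |\lambda^{i}|$. -}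

module Defs where

open import Data.Nat using (ℕ; zero; suc; _+_; _≤_; _>_)
open import Data.List using (List; []; _∷_; length; map; head; last)
open import Data.Nat.ListAction using (sum)
open import Data.Product using (_×_)
open import Data.Sum using (_⊎_)
open import Data.Maybe using (Maybe; just)
open import Relation.Binary.PropositionalEquality using (_≡_)

data Decreasing : List ℕ → Set where
  dec-[] : Decreasing []
  dec-[x] : ∀ {x} → Decreasing (x ∷ [])
  dec-∷ : ∀ {x y ys} → y ≤ x → Decreasing (y ∷ ys) → Decreasing (x ∷ y ∷ ys)

data AllPositive : List ℕ → Set where
  pos-[] : AllPositive []
  pos-∷ : ∀ {x xs} → x > 0 → AllPositive xs → AllPositive (x ∷ xs)

IsPartition : List ℕ → Set
IsPartition p = Decreasing p × AllPositive p

-- i-th part (0-indexed), with 0 beyond the length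
part : List ℕ → ℕ → ℕ
part [] _ = 0
part (x ∷ xs) zero = x
part (x ∷ xs) (suc i) = part xs i

size : List ℕ → ℕ
size = sum

_⊆Y_ : List ℕ → List ℕ → Set
μ ⊆Y λ′ = ∀ i → part μ i ≤ part λ′ i

_⋖_ : List ℕ → List ℕ → Set
μ ⋖ λ′ = IsPartition μ × IsPartition λ′ × μ ⊆Y λ′ × size λ′ ≡ suc (size μ)

data Steps : List (List ℕ) → Set where
  steps-[] : Steps []
  steps-[x] : ∀ {x} → Steps (x ∷ [])
  steps-∷ : ∀ {x y ys} → (x ⋖ y ⊎ y ⋖ x) → Steps (y ∷ ys) → Steps (x ∷ y ∷ ys)

-- T = (λ⁰,…,λˡ) is an oscillating tableau of shape λ and length l
IsOT : List ℕ → ℕ → List (List ℕ) → Set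
IsOT λ′ l T =
  length T ≡ suc l × head T ≡ just [] × last T ≡ just λ′ × Steps T

wt : List (List ℕ) → ℕ
wt T = sum (map size T)

-- For a function F of partitions, U F μ and D F μ sum F over the partitions covering, resp.
-- covered by, μ. Young's lattice is differential: U (D F) = D (U F) + F on partitions, because
-- adding a box in row i and removing one in another row j commute, while a partition has exactly
-- one more addable than removable row. Hence E F h = (Uʰ F)(∅) satisfies E (D F) h = h E F (h - 1).
-- Peeling off the last step of the walks from ∅ then expands the number of oscillating tableaux of
-- shape λ and length l, and their total weight, as Σₕ a l h E δ_λ h and Σₕ b l h E δ_λ h, where
-- a l h counts partial matchings of l points with h unmatched points and b is a weighted count.
-- Only h = |λ| contributes, and for l = h + 2n the closed forms a = l! / (h! 2ⁿ n!) and
-- 6 b = a (2n + h + 1) (2n + 3h) give the average.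

module Submission where

open import Defs
open import Data.Bool using (Bool; true; false; if_then_else_; T; not)
open import Data.Empty using (⊥-elim)
open import Data.List using (List; []; _∷_; _++_; map; length; concatMap; filter; last)
open import Data.List.Membership.Propositional using (_∈_; find; lose)
open import Data.List.Membership.Propositional.Properties
  using (∈-++⁺ˡ; ∈-++⁺ʳ; ∈-++⁻; ∈-map⁺; map∷⁻; ∈-concatMap⁺; ∈-concatMap⁻; ∈-filter⁺; ∈-filter⁻)
open import Data.List.Membership.Propositional.Properties.WithK using (unique∧set⇒bag)
open import Data.List.Properties using (∷-injectiveˡ; ∷-injectiveʳ; ≡-dec)
open import Data.List.Relation.Binary.BagAndSetEquality using (∼bag⇒↭)
open import Data.List.Relation.Binary.Disjoint.Propositional using (Disjoint)
open import Data.List.Relation.Binary.Permutation.Propositional using (_↭_)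
import Data.List.Relation.Binary.Permutation.Propositional.Properties as ↭
open import Data.List.Relation.Unary.All using (All; []; _∷_; tabulate)
import Data.List.Relation.Unary.All.Properties as All
open import Data.List.Relation.Unary.All.Properties using (¬Any⇒All¬)
open import Data.List.Relation.Unary.AllPairs using ([]; _∷_)
import Data.List.Relation.Unary.AllPairs as AllPairs
import Data.List.Relation.Unary.AllPairs.Properties as AllPairs
open import Data.List.Relation.Unary.Any using (here; there)
open import Data.List.Relation.Unary.Unique.Propositional using (Unique)
import Data.List.Relation.Unary.Unique.Propositional.Properties as Unique
open import Data.Maybe using (just)
open import Data.Maybe.Properties using (just-injective)
open import Data.Nat
  using (ℕ; zero; suc; pred; _+_; _*_; _^_; _!; _≤_; _<_; _>_; z≤n; s≤s; _<ᵇ_; _≡ᵇ_; _≟_; >-nonZero)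
open import Data.Nat.ListAction using (sum)
open import Data.Nat.ListAction.Properties using (sum-↭)
open import Data.Nat.Properties
import Algebra.Properties.CommutativeSemigroup +-commutativeSemigroup as +
import Algebra.Properties.CommutativeSemigroup *-commutativeSemigroup as *
open import Data.Nat.Tactic.RingSolver using (solve-∀)
open import Data.Product using (∃-syntax; _×_; _,_; proj₁; proj₂)
open import Data.Sum using (_⊎_; inj₁; inj₂)
open import Data.Unit using (tt)
open import Function using (_∘_)
open import Function.Bundles using (_⇔_; mk⇔)
import Function.Properties.Equivalence as ⇔
open import Level using (Level)
open import Relation.Binary.Definitions using (DecidableEquality)
open import Relation.Binary.PropositionalEquality
open import Relation.Nullary using (does; yes; no)
open import Relation.Unary using (Pred; Decidable)

private variable
  ℓ : Level
  A B : Set ℓ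

-- Finite sums

∑ : (A → ℕ) → List A → ℕ
∑ f xs = sum (map f xs)

∑-cong-∈ : ∀ {f g : A → ℕ} xs → (∀ {x} → x ∈ xs → f x ≡ g x) → ∑ f xs ≡ ∑ g xs
∑-cong-∈ []       f≡g = refl
∑-cong-∈ (x ∷ xs) f≡g = cong₂ _+_ (f≡g (here refl)) (∑-cong-∈ xs (f≡g ∘ there))

∑-cong : ∀ {f g : A → ℕ} xs → (∀ x → f x ≡ g x) → ∑ f xs ≡ ∑ g xs
∑-cong xs f≡g = ∑-cong-∈ xs (λ {x} _ → f≡g x)

∑-zero : (xs : List A) → ∑ (λ _ → 0) xs ≡ 0
∑-zero []       = refl
∑-zero (x ∷ xs) = ∑-zero xs

∑-const-1 : (xs : List A) → ∑ (λ _ → 1) xs ≡ length xs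
∑-const-1 []       = refl
∑-const-1 (x ∷ xs) = cong suc (∑-const-1 xs)

∑-++ : ∀ (f : A → ℕ) xs ys → ∑ f (xs ++ ys) ≡ ∑ f xs + ∑ f ys
∑-++ f []       ys = refl
∑-++ f (x ∷ xs) ys = trans (cong (f x +_) (∑-++ f xs ys)) (sym (+-assoc (f x) _ _))

∑-map : ∀ (f : B → ℕ) (g : A → B) xs → ∑ f (map g xs) ≡ ∑ (f ∘ g) xs
∑-map f g []       = refl
∑-map f g (x ∷ xs) = cong (f (g x) +_) (∑-map f g xs)

∑-concatMap : ∀ (f : B → ℕ) (g : A → List B) xs → ∑ f (concatMap g xs) ≡ ∑ (∑ f ∘ g) xs
∑-concatMap f g []       = refl
∑-concatMap f g (x ∷ xs) =
  trans (∑-++ f (g x) (concatMap g xs)) (cong (∑ f (g x) +_) (∑-concatMap f g xs))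

∑-distrib-+ : ∀ (f g : A → ℕ) xs → ∑ (λ x → f x + g x) xs ≡ ∑ f xs + ∑ g xs
∑-distrib-+ f g []       = refl
∑-distrib-+ f g (x ∷ xs) =
  trans (cong (f x + g x +_) (∑-distrib-+ f g xs)) (+.interchange (f x) (g x) _ _)

∑-distribˡ-* : ∀ (c : ℕ) (f : A → ℕ) xs → ∑ (λ x → c * f x) xs ≡ c * ∑ f xs
∑-distribˡ-* c f []       = sym (*-zeroʳ c)
∑-distribˡ-* c f (x ∷ xs) =
  trans (cong (c * f x +_) (∑-distribˡ-* c f xs)) (sym (*-distribˡ-+ c (f x) _))

when : Bool → ℕ → ℕ
when b x = if b then x else 0

when-* : ∀ b x → when b x ≡ x * when b 1
when-* true  x = sym (*-identityʳ x)
when-* false x = sym (*-zeroʳ x)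

when²-cong : ∀ {a b c d x y} → (T a → T b → T c × T d) → (T c → T d → T a × T b)
  → (T a → T b → x ≡ y)
  → when a (when b x) ≡ when c (when d y)
when²-cong {true}  {true}  {true}  {true}  _  _  x≡y = x≡y tt tt
when²-cong {true}  {true}  {false} {_}     ⇒cd _  _  = ⊥-elim (proj₁ (⇒cd tt tt))
when²-cong {true}  {true}  {true}  {false} ⇒cd _  _  = ⊥-elim (proj₂ (⇒cd tt tt))
when²-cong {false} {_}     {true}  {true}  _  ⇒ab _  = ⊥-elim (proj₁ (⇒ab tt tt))
when²-cong {true}  {false} {true}  {true}  _  ⇒ab _  = ⊥-elim (proj₂ (⇒ab tt tt))
when²-cong {false} {_}     {false} {_}     _  _  _   = refl
when²-cong {false} {_}     {true}  {false} _  _  _   = refl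
when²-cong {true}  {false} {false} {_}     _  _  _   = refl
when²-cong {true}  {false} {true}  {false} _  _  _   = refl

∑-filter : ∀ {p} {P : Pred A p} (P? : Decidable P) (f : A → ℕ) xs
  → ∑ f (filter P? xs) ≡ ∑ (λ x → when (does (P? x)) (f x)) xs
∑-filter P? f []       = refl
∑-filter P? f (x ∷ xs) with does (P? x)
... | true  = cong (f x +_) (∑-filter P? f xs)
... | false = ∑-filter P? f xs

concatMap-Unique : ∀ {f : A → List B} {xs} → Unique xs → All (Unique ∘ f) xs
  → (∀ {x y} → x ≢ y → Disjoint (f x) (f y)) → Unique (concatMap f xs)
concatMap-Unique xs! fx! disjoint = Unique.concat⁺ (All.map⁺ fx!) (AllPairs.map⁺ (AllPairs.map disjoint xs!))

∑< : ℕ → (ℕ → ℕ) → ℕ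
∑< zero    f = 0
∑< (suc n) f = f 0 + ∑< n (f ∘ suc)

∑<-cong : ∀ n {f g : ℕ → ℕ} → (∀ {i} → i < n → f i ≡ g i) → ∑< n f ≡ ∑< n g
∑<-cong zero    f≡g = refl
∑<-cong (suc n) f≡g = cong₂ _+_ (f≡g (s≤s z≤n)) (∑<-cong n (f≡g ∘ s≤s))

∑<-zero : ∀ n {f : ℕ → ℕ} → (∀ i → f i ≡ 0) → ∑< n f ≡ 0
∑<-zero zero    f≡0 = refl
∑<-zero (suc n) f≡0 = cong₂ _+_ (f≡0 0) (∑<-zero n (f≡0 ∘ suc))

∑<-distrib-+ : ∀ n (f g : ℕ → ℕ) → ∑< n (λ i → f i + g i) ≡ ∑< n f + ∑< n g
∑<-distrib-+ zero    f g = refl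
∑<-distrib-+ (suc n) f g =
  trans (cong (f 0 + g 0 +_) (∑<-distrib-+ n (f ∘ suc) (g ∘ suc))) (+.interchange (f 0) (g 0) _ _)

∑<-comm : ∀ m n (f : ℕ → ℕ → ℕ) → ∑< m (λ i → ∑< n (f i)) ≡ ∑< n (λ j → ∑< m (λ i → f i j))
∑<-comm zero    n f = sym (∑<-zero n (λ _ → refl))
∑<-comm (suc m) n f =
  trans (cong (∑< n (f 0) +_) (∑<-comm m n (f ∘ suc)))
        (sym (∑<-distrib-+ n (f 0) (λ j → ∑< m (λ i → f (suc i) j))))

∑<-extend : ∀ {m n} (f : ℕ → ℕ) → m ≤ n → (∀ {i} → m ≤ i → f i ≡ 0) → ∑< n f ≡ ∑< m f
∑<-extend {n = n} f z≤n       f≡0 = ∑<-zero n (λ i → f≡0 z≤n)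
∑<-extend         f (s≤s m≤n) f≡0 = cong (f 0 +_) (∑<-extend (f ∘ suc) m≤n (f≡0 ∘ s≤s))

∑<-pick : ∀ {n} k (f : ℕ → ℕ) → k < n → (∀ {i} → i ≢ k → f i ≡ 0) → ∑< n f ≡ f k
∑<-pick {suc n} zero    f k<n f≡0 =
  trans (cong (f 0 +_) (∑<-zero n (λ i → f≡0 (λ ())))) (+-identityʳ (f 0))
∑<-pick {suc n} (suc k) f (s≤s k<n) f≡0 =
  trans (cong (_+ ∑< n (f ∘ suc)) (f≡0 (λ ())))
        (∑<-pick k (f ∘ suc) k<n (λ i≢k → f≡0 (i≢k ∘ suc-injective)))

when-∑< : ∀ b n (f : ℕ → ℕ) → when b (∑< n f) ≡ ∑< n (when b ∘ f)
when-∑< true  n f = refl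
when-∑< false n f = sym (∑<-zero n (λ _ → refl))

∑<-split : ∀ {n} i (f : ℕ → ℕ) → i < n → ∑< n f ≡ ∑< n (λ j → when (not (i ≡ᵇ j)) (f j)) + f i
∑<-split {suc n} zero    f i<n = +-comm (f 0) _
∑<-split {suc n} (suc i) f (s≤s i<n) =
  trans (cong (f 0 +_) (∑<-split i (f ∘ suc) i<n)) (sym (+-assoc (f 0) _ _))

select : ℕ → (ℕ → Bool) → (ℕ → A) → List A
select zero    b g = []
select (suc n) b g with b 0
... | true  = g 0 ∷ select n (b ∘ suc) (g ∘ suc)
... | false = select n (b ∘ suc) (g ∘ suc)

∑-select : ∀ (f : A → ℕ) n b g → ∑ f (select n b g) ≡ ∑< n (λ i → when (b i) (f (g i)))
∑-select f zero    b g = refl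
∑-select f (suc n) b g with b 0
... | true  = cong (f (g 0) +_) (∑-select f n (b ∘ suc) (g ∘ suc))
... | false = ∑-select f n (b ∘ suc) (g ∘ suc)

∈-select⁻ : ∀ {x : A} n b g → x ∈ select n b g → ∃[ i ] i < n × T (b i) × x ≡ g i
∈-select⁻ (suc n) b g x∈ with b 0 in b0
∈-select⁻ (suc n) b g (here refl) | true = 0 , s≤s z≤n , subst T (sym b0) tt , refl
∈-select⁻ (suc n) b g (there x∈) | true with ∈-select⁻ n (b ∘ suc) (g ∘ suc) x∈
... | i , i<n , bi , x≡ = suc i , s≤s i<n , bi , x≡
∈-select⁻ (suc n) b g x∈ | false with ∈-select⁻ n (b ∘ suc) (g ∘ suc) x∈
... | i , i<n , bi , x≡ = suc i , s≤s i<n , bi , x≡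

∈-select⁺ : ∀ {n} b (g : ℕ → A) {i} → i < n → T (b i) → g i ∈ select n b g
∈-select⁺ {n = suc n} b g {i} i<n bi with b 0 in b0
∈-select⁺ b g {zero}  i<n       bi | true  = here refl
∈-select⁺ b g {suc i} (s≤s i<n) bi | true  = there (∈-select⁺ (b ∘ suc) (g ∘ suc) i<n bi)
∈-select⁺ b g {zero}  i<n       bi | false = ⊥-elim (subst T b0 bi)
∈-select⁺ b g {suc i} (s≤s i<n) bi | false = ∈-select⁺ (b ∘ suc) (g ∘ suc) i<n bi

select-Unique : ∀ n b (g : ℕ → A) → (∀ {i j} → T (b i) → T (b j) → g i ≡ g j → i ≡ j)
  → Unique (select n b g)
select-Unique zero    b g inj = []
select-Unique (suc n) b g inj with b 0 in b0
... | true  = fresh ∷ select-Unique n (b ∘ suc) (g ∘ suc) (λ bi bj → suc-injective ∘ inj bi bj)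
  where
  fresh : All (g 0 ≢_) (select n (b ∘ suc) (g ∘ suc))
  fresh = ¬Any⇒All¬ _ λ g0∈ → let i , _ , bi , g0≡ = ∈-select⁻ n (b ∘ suc) (g ∘ suc) g0∈
                              in 0≢1+n (inj (subst T (sym b0) tt) bi g0≡)
... | false = select-Unique n (b ∘ suc) (g ∘ suc) (λ bi bj → suc-injective ∘ inj bi bj)

offDiagonal : ℕ → (ℕ → ℕ → ℕ) → ℕ
offDiagonal n t = ∑< n (λ i → ∑< n (λ j → when (not (i ≡ᵇ j)) (t i j)))

∑<²-split-diagonal : ∀ n (t : ℕ → ℕ → ℕ)
  → ∑< n (λ i → ∑< n (t i)) ≡ offDiagonal n t + ∑< n (λ i → t i i)
∑<²-split-diagonal n t =
  trans (∑<-cong n (λ {i} i<n → ∑<-split i (t i) i<n))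
        (∑<-distrib-+ n (λ i → ∑< n (λ j → when (not (i ≡ᵇ j)) (t i j))) (λ i → t i i))

offDiagonal-transpose : ∀ n (t s : ℕ → ℕ → ℕ) → (∀ {i j} → i ≢ j → t i j ≡ s j i)
  → offDiagonal n t ≡ offDiagonal n s
offDiagonal-transpose n t s t≡s =
  trans (∑<-cong n (λ {i} _ → ∑<-cong n (λ {j} _ → when-≢ i j (t≡s {i} {j}))))
        (∑<-comm n n (λ i j → when (not (j ≡ᵇ i)) (s j i)))
  where
  when-≢ : ∀ i j {x y} → (i ≢ j → x ≡ y) → when (not (i ≡ᵇ j)) x ≡ when (not (j ≡ᵇ i)) y
  when-≢ zero    zero    _   = refl
  when-≢ zero    (suc j) x≡y = x≡y (λ ())
  when-≢ (suc i) zero    x≡y = x≡y (λ ())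
  when-≢ (suc i) (suc j) x≡y = when-≢ i j (λ i≢j → x≡y (i≢j ∘ suc-injective))

-- Adding and removing boxes

-- Rows are numbered from 0; addBox μ i and removeBox μ j are meaningful only for an addable row i
-- and a removable row j.

addBox : List ℕ → ℕ → List ℕ
addBox []       _       = 1 ∷ []
addBox (x ∷ xs) zero    = suc x ∷ xs
addBox (x ∷ xs) (suc i) = x ∷ addBox xs i

removeBox : List ℕ → ℕ → List ℕ
removeBox []                 _       = []
removeBox (x ∷ xs)           (suc j) = x ∷ removeBox xs j
removeBox (suc (suc x) ∷ xs) zero    = suc x ∷ xs
removeBox (_ ∷ xs)           zero    = xs

addable : List ℕ → ℕ → Bool
addable μ zero    = true
addable μ (suc i) = part μ (suc i) <ᵇ part μ i

removable : List ℕ → ℕ → Bool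
removable μ j = part μ (suc j) <ᵇ part μ j

addable-tail : ∀ {x} μ i → T (addable (x ∷ μ) (suc i)) → T (addable μ i)
addable-tail μ zero    _ = tt
addable-tail μ (suc i) a = a

part-addBox-≡ : ∀ μ i → T (addable μ i) → part (addBox μ i) i ≡ suc (part μ i)
part-addBox-≡ []       zero    _ = refl
part-addBox-≡ (x ∷ μ)  zero    _ = refl
part-addBox-≡ (x ∷ μ)  (suc i) a = part-addBox-≡ μ i (addable-tail μ i a)

part-addBox-≢ : ∀ μ i {k} → T (addable μ i) → k ≢ i → part (addBox μ i) k ≡ part μ k
part-addBox-≢ []      zero    {zero}  _ k≢i = ⊥-elim (k≢i refl)
part-addBox-≢ []      zero    {suc k} _ _   = refl
part-addBox-≢ (x ∷ μ) zero    {zero}  _ k≢i = ⊥-elim (k≢i refl)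
part-addBox-≢ (x ∷ μ) zero    {suc k} _ _   = refl
part-addBox-≢ (x ∷ μ) (suc i) {zero}  _ _   = refl
part-addBox-≢ (x ∷ μ) (suc i) {suc k} a k≢i =
  part-addBox-≢ μ i (addable-tail μ i a) (k≢i ∘ cong suc)

removable⇒part>0 : ∀ μ j → T (removable μ j) → part μ j > 0
removable⇒part>0 μ j r = ≤-<-trans z≤n (<ᵇ⇒< _ _ r)

part-removeBox-≡ : ∀ μ j → AllPositive μ → T (removable μ j)
  → part (removeBox μ j) j ≡ pred (part μ j)
part-removeBox-≡ (zero ∷ μ)               zero    (pos-∷ () _) r
part-removeBox-≡ (suc zero ∷ [])          zero    _ r = refl
part-removeBox-≡ (suc zero ∷ y ∷ μ)       zero    (pos-∷ _ (pos-∷ y>0 _)) r =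
  ⊥-elim (<⇒≱ (<ᵇ⇒< _ _ r) y>0)
part-removeBox-≡ (suc (suc x) ∷ μ)        zero    _ r = refl
part-removeBox-≡ (x ∷ μ)                  (suc j) (pos-∷ _ p) r = part-removeBox-≡ μ j p r

part-removeBox-≢ : ∀ μ j {k} → AllPositive μ → T (removable μ j) → k ≢ j
  → part (removeBox μ j) k ≡ part μ k
part-removeBox-≢ (zero ∷ μ)         zero    {k}     (pos-∷ () _) r k≢j
part-removeBox-≢ (suc zero ∷ [])    zero    {zero}  _ r k≢j = ⊥-elim (k≢j refl)
part-removeBox-≢ (suc zero ∷ [])    zero    {suc k} _ r k≢j = refl
part-removeBox-≢ (suc zero ∷ y ∷ μ) zero    {k}     (pos-∷ _ (pos-∷ y>0 _)) r k≢j =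
  ⊥-elim (<⇒≱ (<ᵇ⇒< _ _ r) y>0)
part-removeBox-≢ (suc (suc x) ∷ μ)  zero    {zero}  _ r k≢j = ⊥-elim (k≢j refl)
part-removeBox-≢ (suc (suc x) ∷ μ)  zero    {suc k} _ r k≢j = refl
part-removeBox-≢ (x ∷ μ)            (suc j) {zero}  _ r k≢j = refl
part-removeBox-≢ (x ∷ μ)            (suc j) {suc k} (pos-∷ _ p) r k≢j =
  part-removeBox-≢ μ j p r (k≢j ∘ cong suc)

part-addBox-≥ : ∀ μ i k → part μ k ≤ part (addBox μ i) k
part-addBox-≥ []      i       k       = z≤n
part-addBox-≥ (x ∷ μ) zero    zero    = n≤1+n x
part-addBox-≥ (x ∷ μ) zero    (suc k) = ≤-refl
part-addBox-≥ (x ∷ μ) (suc i) zero    = ≤-refl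
part-addBox-≥ (x ∷ μ) (suc i) (suc k) = part-addBox-≥ μ i k

part-removeBox-≤ : ∀ μ j k → AllPositive μ → T (removable μ j) → part (removeBox μ j) k ≤ part μ k
part-removeBox-≤ μ j k p r with k ≟ j
... | yes refl = subst (_≤ part μ k) (sym (part-removeBox-≡ μ k p r)) pred[n]≤n
... | no k≢j   = ≤-reflexive (part-removeBox-≢ μ j p r k≢j)

size-addBox : ∀ μ i → size (addBox μ i) ≡ suc (size μ)
size-addBox []      i       = refl
size-addBox (x ∷ μ) zero    = refl
size-addBox (x ∷ μ) (suc i) = trans (cong (x +_) (size-addBox μ i)) (+-suc x (size μ))

size-removeBox : ∀ μ j → T (removable μ j) → suc (size (removeBox μ j)) ≡ size μ
size-removeBox (zero ∷ μ)        zero    r = ⊥-elim (n≮0 (<ᵇ⇒< (part μ 0) 0 r))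
size-removeBox (suc zero ∷ μ)    zero    r = refl
size-removeBox (suc (suc x) ∷ μ) zero    r = refl
size-removeBox (x ∷ μ)           (suc j) r =
  trans (sym (+-suc x _)) (cong (x +_) (size-removeBox μ j r))

addable⇒≤length : ∀ μ i → T (addable μ i) → i ≤ length μ
addable⇒≤length μ       zero    _ = z≤n
addable⇒≤length []      (suc i) ()
addable⇒≤length (x ∷ μ) (suc i) a = s≤s (addable⇒≤length μ i (addable-tail μ i a))

removable⇒<length : ∀ μ j → T (removable μ j) → j < length μ
removable⇒<length []      j       ()
removable⇒<length (x ∷ μ) zero    r = s≤s z≤n
removable⇒<length (x ∷ μ) (suc j) r = s≤s (removable⇒<length μ j r)

addable-beyond : ∀ μ {i} → suc (length μ) ≤ i → addable μ i ≡ false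
addable-beyond μ {i} i> with addable μ i in a
... | false = refl
... | true  = ⊥-elim (<⇒≱ i> (addable⇒≤length μ i (subst T (sym a) tt)))

removable-beyond : ∀ μ {j} → length μ ≤ j → removable μ j ≡ false
removable-beyond μ {j} j≥ with removable μ j in r
... | false = refl
... | true  = ⊥-elim (<⇒≱ (removable⇒<length μ j (subst T (sym r) tt)) j≥)

length-addBox : ∀ μ i → length (addBox μ i) ≤ suc (length μ)
length-addBox []      i       = s≤s z≤n
length-addBox (x ∷ μ) zero    = n≤1+n _
length-addBox (x ∷ μ) (suc i) = s≤s (length-addBox μ i)

length-removeBox : ∀ μ j → length (removeBox μ j) ≤ length μ
length-removeBox []                j       = z≤n
length-removeBox (x ∷ μ)           (suc j) = s≤s (length-removeBox μ j)
length-removeBox (zero ∷ μ)        zero    = n≤1+n _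
length-removeBox (suc zero ∷ μ)    zero    = n≤1+n _
length-removeBox (suc (suc x) ∷ μ) zero    = ≤-refl

decreasing-∷ : ∀ x ys → Decreasing ys → part ys 0 ≤ x → Decreasing (x ∷ ys)
decreasing-∷ x []       d _   = dec-[x]
decreasing-∷ x (y ∷ ys) d y≤x = dec-∷ y≤x d

decreasing-tail : ∀ {x ys} → Decreasing (x ∷ ys) → Decreasing ys
decreasing-tail dec-[x]     = dec-[]
decreasing-tail (dec-∷ _ d) = d

decreasing-head : ∀ {x ys} → Decreasing (x ∷ ys) → part ys 0 ≤ x
decreasing-head dec-[x]       = z≤n
decreasing-head (dec-∷ y≤x _) = y≤x

decreasing-part : ∀ {μ} → Decreasing μ → ∀ k → part μ (suc k) ≤ part μ k
decreasing-part dec-[]       k       = z≤n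
decreasing-part dec-[x]      k       = z≤n
decreasing-part (dec-∷ y≤x _) zero    = y≤x
decreasing-part (dec-∷ _ d)   (suc k) = decreasing-part d k

isPartition-tail : ∀ {x ys} → IsPartition (x ∷ ys) → IsPartition ys
isPartition-tail (d , pos-∷ _ p) = decreasing-tail d , p

isPartition-[] : IsPartition []
isPartition-[] = dec-[] , pos-[]

isPartition-addBox : ∀ μ i → IsPartition μ → T (addable μ i) → IsPartition (addBox μ i)
isPartition-addBox []      zero    _                 _ = dec-[x] , pos-∷ (s≤s z≤n) pos-[]
isPartition-addBox (x ∷ μ) zero    (d , pos-∷ _ p)   _ =
  decreasing-∷ (suc x) μ (decreasing-tail d) (m≤n⇒m≤1+n (decreasing-head d)) , pos-∷ (s≤s z≤n) p
isPartition-addBox (x ∷ μ) (suc i) (d , pos-∷ x>0 p) a =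
  let d′ , p′ = isPartition-addBox μ i (decreasing-tail d , p) (addable-tail μ i a)
  in decreasing-∷ x (addBox μ i) d′ (head≤ i a) , pos-∷ x>0 p′
  where
  head≤ : ∀ i → T (addable (x ∷ μ) (suc i)) → part (addBox μ i) 0 ≤ x
  head≤ zero    a = subst (_≤ x) (sym (part-addBox-≡ μ 0 tt)) (<ᵇ⇒< _ _ a)
  head≤ (suc i) a = subst (_≤ x) (sym (part-addBox-≢ μ (suc i) a λ ())) (decreasing-head d)

part0<1⇒[] : ∀ μ → AllPositive μ → part μ 0 < 1 → μ ≡ []
part0<1⇒[] []      _             _   = refl
part0<1⇒[] (y ∷ μ) (pos-∷ y>0 _) y<1 = ⊥-elim (<⇒≱ y<1 y>0)

isPartition-removeBox : ∀ μ j → IsPartition μ → T (removable μ j) → IsPartition (removeBox μ j)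
isPartition-removeBox (zero ∷ μ)        zero    (d , pos-∷ () p) r
isPartition-removeBox (suc zero ∷ μ)    zero    (d , pos-∷ _ p)  r
  with refl ← part0<1⇒[] μ p (<ᵇ⇒< _ _ r) = isPartition-[]
isPartition-removeBox (suc (suc x) ∷ μ) zero    (d , pos-∷ _ p)  r =
  decreasing-∷ (suc x) μ (decreasing-tail d) (≤-pred (<ᵇ⇒< _ _ r)) , pos-∷ (s≤s z≤n) p
isPartition-removeBox (x ∷ μ)           (suc j) (d , pos-∷ x>0 p) r =
  let d′ , p′ = isPartition-removeBox μ j (decreasing-tail d , p) r
  in decreasing-∷ x (removeBox μ j) d′ (≤-trans (head≤ j r) (decreasing-head d)) , pos-∷ x>0 p′
  where
  head≤ : ∀ j → T (removable μ j) → part (removeBox μ j) 0 ≤ part μ 0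
  head≤ zero    r = subst (_≤ part μ 0) (sym (part-removeBox-≡ μ 0 p r)) pred[n]≤n
  head≤ (suc j) r = ≤-reflexive (part-removeBox-≢ μ (suc j) p r λ ())

part-extensional : ∀ {μ ν} → AllPositive μ → AllPositive ν → (∀ k → part μ k ≡ part ν k) → μ ≡ ν
part-extensional pos-[]          pos-[]          _  = refl
part-extensional pos-[]          (pos-∷ y>0 _)   eq = ⊥-elim (<⇒≢ y>0 (eq 0))
part-extensional (pos-∷ x>0 _)   pos-[]          eq = ⊥-elim (<⇒≢ x>0 (sym (eq 0)))
part-extensional (pos-∷ _ p)     (pos-∷ _ q)     eq =
  cong₂ _∷_ (eq 0) (part-extensional p q (eq ∘ suc))

-- Covering relation

size-mono : ∀ μ ν → μ ⊆Y ν → size μ ≤ size ν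
size-mono []      ν       _   = z≤n
size-mono (x ∷ μ) []      μ⊆ν = +-mono-≤ (μ⊆ν 0) (size-mono μ [] (μ⊆ν ∘ suc))
size-mono (x ∷ μ) (y ∷ ν) μ⊆ν = +-mono-≤ (μ⊆ν 0) (size-mono μ ν (μ⊆ν ∘ suc))

⊆Y∧size≤⇒part≡ : ∀ μ ν → μ ⊆Y ν → size ν ≤ size μ → ∀ k → part μ k ≡ part ν k
⊆Y∧size≤⇒part≡ μ       []      μ⊆ν _  k       = n≤0⇒n≡0 (μ⊆ν k)
⊆Y∧size≤⇒part≡ []      (y ∷ ν) _   ≤0 zero    = sym (n≤0⇒n≡0 (m+n≤o⇒m≤o y ≤0))
⊆Y∧size≤⇒part≡ []      (y ∷ ν) _   ≤0 (suc k) =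
  ⊆Y∧size≤⇒part≡ [] ν (λ _ → z≤n) (m+n≤o⇒n≤o y ≤0) k
⊆Y∧size≤⇒part≡ (x ∷ μ) (y ∷ ν) μ⊆ν ≤s = parts
  where
  x≡y : x ≡ y
  x≡y with m≤n⇒m<n∨m≡n (μ⊆ν 0)
  ... | inj₂ x≡y = x≡y
  ... | inj₁ x<y = ⊥-elim (<⇒≱ (+-mono-<-≤ x<y (size-mono μ ν (μ⊆ν ∘ suc))) ≤s)
  parts : ∀ k → part (x ∷ μ) k ≡ part (y ∷ ν) k
  parts zero    = x≡y
  parts (suc k) =
    ⊆Y∧size≤⇒part≡ μ ν (μ⊆ν ∘ suc) (+-cancelˡ-≤ y _ _ (subst (λ z → y + size ν ≤ z + size μ) x≡y ≤s)) k

size≡0⇒[] : ∀ {μ} → AllPositive μ → size μ ≡ 0 → μ ≡ []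
size≡0⇒[] pos-[]               _  = refl
size≡0⇒[] (pos-∷ {suc x} _ _) ()

⋖⇒addBox : ∀ μ ν → IsPartition μ → IsPartition ν → μ ⊆Y ν → size ν ≡ suc (size μ)
  → ∃[ i ] i < suc (length μ) × T (addable μ i) × ν ≡ addBox μ i
⋖⇒addBox []      []                 _  _                  _   ()
⋖⇒addBox []      (zero ∷ ν)         _  (_ , pos-∷ () _)   _   _
⋖⇒addBox []      (suc zero ∷ ν)     _  (_ , pos-∷ _ p)    _   s
  with refl ← size≡0⇒[] p (suc-injective s) = 0 , s≤s z≤n , tt , refl
⋖⇒addBox []      (suc (suc y) ∷ ν)  _  _                  _   ()
⋖⇒addBox (x ∷ μ) []                 _  _                  _   ()
⋖⇒addBox (x ∷ μ) (y ∷ ν)            pμ pν                 μ⊆ν s with m≤n⇒m<n∨m≡n (μ⊆ν 0)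
... | inj₂ refl =
  let i , i< , a , ν≡ = ⋖⇒addBox μ ν (isPartition-tail pμ) (isPartition-tail pν) (μ⊆ν ∘ suc)
                          (+-cancelˡ-≡ x _ _ (trans s (sym (+-suc x (size μ)))))
  in suc i , s≤s i< , addable-∷ i a ν≡ , cong (x ∷_) ν≡
  where
  addable-∷ : ∀ i → T (addable μ i) → ν ≡ addBox μ i → T (addable (x ∷ μ) (suc i))
  addable-∷ zero    _ refl = <⇒<ᵇ (subst (_≤ x) (part-addBox-≡ μ 0 tt) (decreasing-head (proj₁ pν)))
  addable-∷ (suc i) a _    = a
... | inj₁ x<y = 0 , s≤s z≤n , tt , cong₂ _∷_ y≡1+x ν≡μ
  where
  size≤ : size ν ≤ size μ
  size≤ = +-cancelˡ-≤ (suc x) _ _ (≤-trans (+-monoˡ-≤ (size ν) x<y) (≤-reflexive s))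
  ν≡μ : ν ≡ μ
  ν≡μ = sym (part-extensional (proj₂ (isPartition-tail pμ)) (proj₂ (isPartition-tail pν))
               (⊆Y∧size≤⇒part≡ μ ν (μ⊆ν ∘ suc) size≤))
  y≡1+x : y ≡ suc x
  y≡1+x = +-cancelʳ-≡ (size μ) y (suc x) (trans (cong (λ ρ → y + size ρ) (sym ν≡μ)) s)

module _ {μ : List ℕ} (pμ : IsPartition μ) where

  private
    pos = proj₂ pμ
    dec = proj₁ pμ

  removable-addBox : ∀ i → T (addable μ i) → T (removable (addBox μ i) i)
  removable-addBox i a = <⇒<ᵇ (subst₂ _<_ (sym (part-addBox-≢ μ i a 1+n≢n)) (sym (part-addBox-≡ μ i a))
                                          (s≤s (decreasing-part dec i)))

  removeBox-addBox : ∀ i → T (addable μ i) → removeBox (addBox μ i) i ≡ μ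
  removeBox-addBox i a = part-extensional (proj₂ (isPartition-removeBox _ i pa r)) pos parts
    where
    pa = isPartition-addBox μ i pμ a
    r  = removable-addBox i a
    parts : ∀ k → part (removeBox (addBox μ i) i) k ≡ part μ k
    parts k with k ≟ i
    ... | yes refl = trans (part-removeBox-≡ _ k (proj₂ pa) r) (cong pred (part-addBox-≡ μ k a))
    ... | no k≢i   = trans (part-removeBox-≢ _ i (proj₂ pa) r k≢i) (part-addBox-≢ μ i a k≢i)

  addable-removeBox : ∀ j → T (removable μ j) → T (addable (removeBox μ j) j)
  addable-removeBox zero    r = tt
  addable-removeBox (suc j) r =
    <⇒<ᵇ (subst₂ _<_ (sym (part-removeBox-≡ μ (suc j) pos r))
                     (sym (part-removeBox-≢ μ (suc j) pos r (1+n≢n ∘ sym)))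
                     (pred<≤ (removable⇒part>0 μ (suc j) r) (decreasing-part dec j)))
    where
    pred<≤ : ∀ {m n} → m > 0 → m ≤ n → pred m < n
    pred<≤ {suc m} _ (s≤s m≤n) = s≤s m≤n

  addBox-removeBox : ∀ j → T (removable μ j) → addBox (removeBox μ j) j ≡ μ
  addBox-removeBox j r = part-extensional (proj₂ (isPartition-addBox _ j pr a)) pos parts
    where
    pr = isPartition-removeBox μ j pμ r
    a  = addable-removeBox j r
    parts : ∀ k → part (addBox (removeBox μ j) j) k ≡ part μ k
    parts k with k ≟ j
    ... | yes refl = trans (part-addBox-≡ _ k a)
                           (trans (cong suc (part-removeBox-≡ μ k pos r))
                                  (suc-pred (part μ k) ⦃ >-nonZero (removable⇒part>0 μ k r) ⦄))
    ... | no k≢j   = trans (part-addBox-≢ _ j a k≢j) (part-removeBox-≢ μ j pos r k≢j)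

  removable-before-addBox : ∀ {i j} → i ≢ j → T (addable μ i) → T (removable (addBox μ i) j)
    → T (removable μ j)
  removable-before-addBox {i} {j} i≢j a r =
    <⇒<ᵇ (≤-<-trans (part-addBox-≥ μ i (suc j))
                    (subst (part (addBox μ i) (suc j) <_) (part-addBox-≢ μ i a (i≢j ∘ sym)) (<ᵇ⇒< _ _ r)))

  addable-after-removeBox : ∀ {i j} → i ≢ j → T (addable μ i) → T (removable (addBox μ i) j)
    → T (addable (removeBox μ j) i)
  addable-after-removeBox {zero}  {j} i≢j a r′ = tt
  addable-after-removeBox {suc i} {j} i≢j a r′ with i ≟ j
  ... | yes refl = <⇒<ᵇ (subst₂ _<_ (sym (part-removeBox-≢ μ i pos r i≢j)) (sym (part-removeBox-≡ μ i pos r))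
                          (suc<⇒<pred (subst₂ _<_ (part-addBox-≡ μ (suc i) a) (part-addBox-≢ μ (suc i) a (i≢j ∘ sym))
                                                (<ᵇ⇒< _ _ r′))))
    where
    r = removable-before-addBox i≢j a r′
    suc<⇒<pred : ∀ {m n} → suc m < n → m < pred n
    suc<⇒<pred {n = suc n} (s≤s m<n) = m<n
  ... | no i≢j′  = <⇒<ᵇ (subst₂ _<_ (sym (part-removeBox-≢ μ j pos r i≢j))
                                    (sym (part-removeBox-≢ μ j pos r i≢j′))
                          (<ᵇ⇒< _ _ a))
    where
    r = removable-before-addBox i≢j a r′

  addable-before-removeBox : ∀ {i j} → i ≢ j → T (removable μ j) → T (addable (removeBox μ j) i)
    → T (addable μ i)
  addable-before-removeBox {zero}  i≢j r a′ = tt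
  addable-before-removeBox {suc i} i≢j r a′ =
    <⇒<ᵇ (<-≤-trans (subst (_< part (removeBox μ _) i) (part-removeBox-≢ μ _ pos r i≢j) (<ᵇ⇒< _ _ a′))
                    (part-removeBox-≤ μ _ i pos r))

  removable-after-addBox : ∀ {i j} → i ≢ j → T (removable μ j) → T (addable (removeBox μ j) i)
    → T (removable (addBox μ i) j)
  removable-after-addBox {i} {j} i≢j r a′ with suc j ≟ i
  ... | yes refl = <⇒<ᵇ (subst₂ _<_ (sym (part-addBox-≡ μ (suc j) a))
                                    (sym (part-addBox-≢ μ (suc j) a (i≢j ∘ sym)))
                          (<pred⇒suc< (removable⇒part>0 μ j r)
                            (subst₂ _<_ (part-removeBox-≢ μ j pos r 1+n≢n) (part-removeBox-≡ μ j pos r)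
                                        (<ᵇ⇒< _ _ a′))))
    where
    a = addable-before-removeBox i≢j r a′
    <pred⇒suc< : ∀ {m n} → n > 0 → m < pred n → suc m < n
    <pred⇒suc< {n = suc n} _ m<n = s≤s m<n
  ... | no 1+j≢i = <⇒<ᵇ (subst₂ _<_ (sym (part-addBox-≢ μ i a 1+j≢i))
                                    (sym (part-addBox-≢ μ i a (i≢j ∘ sym)))
                          (<ᵇ⇒< _ _ r))
    where
    a = addable-before-removeBox i≢j r a′

  removeBox-addBox-comm : ∀ {i j} → i ≢ j → T (addable μ i) → T (removable (addBox μ i) j)
    → removeBox (addBox μ i) j ≡ addBox (removeBox μ j) i
  removeBox-addBox-comm {i} {j} i≢j a r′ =
    part-extensional (proj₂ (isPartition-removeBox _ j pa r′)) (proj₂ (isPartition-addBox _ i pr a′)) parts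
    where
    r  = removable-before-addBox i≢j a r′
    a′ = addable-after-removeBox i≢j a r′
    pa = isPartition-addBox μ i pμ a
    pr = isPartition-removeBox μ j pμ r
    open ≡-Reasoning
    parts : ∀ k → part (removeBox (addBox μ i) j) k ≡ part (addBox (removeBox μ j) i) k
    parts k with k ≟ i | k ≟ j
    ... | yes refl | yes refl = ⊥-elim (i≢j refl)
    ... | yes refl | no k≢j   = begin
      part (removeBox (addBox μ k) j) k  ≡⟨ part-removeBox-≢ _ j (proj₂ pa) r′ k≢j ⟩
      part (addBox μ k) k                ≡⟨ part-addBox-≡ μ k a ⟩
      suc (part μ k)                     ≡⟨ cong suc (part-removeBox-≢ μ j pos r k≢j) ⟨
      suc (part (removeBox μ j) k)       ≡⟨ part-addBox-≡ _ k a′ ⟨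
      part (addBox (removeBox μ j) k) k  ∎
    ... | no k≢i   | yes refl = begin
      part (removeBox (addBox μ i) k) k  ≡⟨ part-removeBox-≡ _ k (proj₂ pa) r′ ⟩
      pred (part (addBox μ i) k)         ≡⟨ cong pred (part-addBox-≢ μ i a k≢i) ⟩
      pred (part μ k)                    ≡⟨ part-removeBox-≡ μ k pos r ⟨
      part (removeBox μ k) k             ≡⟨ part-addBox-≢ _ i a′ k≢i ⟨
      part (addBox (removeBox μ k) i) k  ∎
    ... | no k≢i   | no k≢j   = begin
      part (removeBox (addBox μ i) j) k  ≡⟨ part-removeBox-≢ _ j (proj₂ pa) r′ k≢j ⟩
      part (addBox μ i) k                ≡⟨ part-addBox-≢ μ i a k≢i ⟩
      part μ k                           ≡⟨ part-removeBox-≢ μ j pos r k≢j ⟨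
      part (removeBox μ j) k             ≡⟨ part-addBox-≢ _ i a′ k≢i ⟨
      part (addBox (removeBox μ j) i) k  ∎

upper : List ℕ → List (List ℕ)
upper μ = select (suc (length μ)) (addable μ) (addBox μ)

lower : List ℕ → List (List ℕ)
lower μ = select (length μ) (removable μ) (removeBox μ)

∈-upper⁻ : ∀ {μ ν} → IsPartition μ → ν ∈ upper μ → μ ⋖ ν
∈-upper⁻ {μ} pμ ν∈ with ∈-select⁻ (suc (length μ)) (addable μ) (addBox μ) ν∈
... | i , _ , a , refl = pμ , isPartition-addBox μ i pμ a , part-addBox-≥ μ i , size-addBox μ i

∈-upper⁺ : ∀ {μ ν} → μ ⋖ ν → ν ∈ upper μ
∈-upper⁺ {μ} {ν} (pμ , pν , μ⊆ν , s) with ⋖⇒addBox μ ν pμ pν μ⊆ν s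
... | i , i< , a , refl = ∈-select⁺ (addable μ) (addBox μ) i< a

∈-lower⁻ : ∀ {μ ν} → IsPartition μ → ν ∈ lower μ → ν ⋖ μ
∈-lower⁻ {μ} pμ ν∈ with ∈-select⁻ (length μ) (removable μ) (removeBox μ) ν∈
... | j , _ , r , refl =
  isPartition-removeBox μ j pμ r , pμ , (λ k → part-removeBox-≤ μ j k (proj₂ pμ) r) , sym (size-removeBox μ j r)

∈-lower⁺ : ∀ {μ ν} → ν ⋖ μ → ν ∈ lower μ
∈-lower⁺ {μ} {ν} (pν , pμ , ν⊆μ , s) with ⋖⇒addBox ν μ pν pμ ν⊆μ s
... | i , _ , a , refl = subst (_∈ lower (addBox ν i)) (removeBox-addBox pν i a)
  (∈-select⁺ (removable (addBox ν i)) (removeBox (addBox ν i))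
     (removable⇒<length (addBox ν i) i r) r)
  where r = removable-addBox pν i a

upper-Unique : ∀ μ → Unique (upper μ)
upper-Unique μ = select-Unique (suc (length μ)) (addable μ) (addBox μ) inj
  where
  inj : ∀ {i j} → T (addable μ i) → T (addable μ j) → addBox μ i ≡ addBox μ j → i ≡ j
  inj {i} {j} ai aj eq with i ≟ j
  ... | yes i≡j = i≡j
  ... | no i≢j  = ⊥-elim (1+n≢n (trans (sym (part-addBox-≡ μ i ai))
                                  (trans (cong (λ ν → part ν i) eq) (part-addBox-≢ μ j aj i≢j))))

lower-Unique : ∀ {μ} → AllPositive μ → Unique (lower μ)
lower-Unique {μ} p = select-Unique (length μ) (removable μ) (removeBox μ) inj
  where
  inj : ∀ {i j} → T (removable μ i) → T (removable μ j) → removeBox μ i ≡ removeBox μ j → i ≡ j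
  inj {i} {j} ri rj eq with i ≟ j
  ... | yes i≡j = i≡j
  ... | no i≢j  = ⊥-elim (<⇒≢ (pred< (removable⇒part>0 μ i ri))
                            (trans (sym (part-removeBox-≡ μ i p ri))
                              (trans (cong (λ ν → part ν i) eq) (part-removeBox-≢ μ j p rj i≢j))))
    where
    pred< : ∀ {n} → n > 0 → pred n < n
    pred< {suc n} _ = ≤-refl

∑-upper : ∀ (F : List ℕ → ℕ) μ {n} → suc (length μ) ≤ n
  → ∑ F (upper μ) ≡ ∑< n (λ i → when (addable μ i) (F (addBox μ i)))
∑-upper F μ n≥ = trans (∑-select F (suc (length μ)) (addable μ) (addBox μ))
                       (sym (∑<-extend _ n≥ λ {i} i> →
                              cong (λ b → when b (F (addBox μ i))) (addable-beyond μ i>)))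

∑-lower : ∀ (F : List ℕ → ℕ) μ {n} → length μ ≤ n
  → ∑ F (lower μ) ≡ ∑< n (λ j → when (removable μ j) (F (removeBox μ j)))
∑-lower F μ n≥ = trans (∑-select F (length μ) (removable μ) (removeBox μ))
                       (sym (∑<-extend _ n≥ λ {j} j≥ →
                              cong (λ b → when b (F (removeBox μ j))) (removable-beyond μ j≥)))

-- U (D G) μ and D (U G) μ are double sums over rows i, j: add a box in row i and then remove one
-- in row j, or remove one in row j and then add one in row i.
module _ {μ : List ℕ} (pμ : IsPartition μ) (G : List ℕ → ℕ) where

  private
    n = suc (length μ)

    addRemove : ℕ → ℕ → ℕ
    addRemove i j = when (addable μ i) (when (removable (addBox μ i) j) (G (removeBox (addBox μ i) j)))

    removeAdd : ℕ → ℕ → ℕ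
    removeAdd j i = when (removable μ j) (when (addable (removeBox μ j) i) (G (addBox (removeBox μ j) i)))

    addRemove-diagonal : ∀ i → addRemove i i ≡ when (addable μ i) (G μ)
    addRemove-diagonal i with addable μ i in a
    ... | false = refl
    ... | true with removable (addBox μ i) i in r
    ...   | true  = cong G (removeBox-addBox pμ i (subst T (sym a) tt))
    ...   | false = ⊥-elim (subst T r (removable-addBox pμ i (subst T (sym a) tt)))

    removeAdd-diagonal : ∀ j → removeAdd j j ≡ when (removable μ j) (G μ)
    removeAdd-diagonal j with removable μ j in r
    ... | false = refl
    ... | true with addable (removeBox μ j) j in a
    ...   | true  = cong G (addBox-removeBox pμ j (subst T (sym r) tt))
    ...   | false = ⊥-elim (subst T a (addable-removeBox pμ j (subst T (sym r) tt)))

    addRemove≡removeAdd : ∀ {i j} → i ≢ j → addRemove i j ≡ removeAdd j i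
    addRemove≡removeAdd i≢j =
      when²-cong (λ a r → removable-before-addBox pμ i≢j a r , addable-after-removeBox pμ i≢j a r)
                 (λ r a → addable-before-removeBox pμ i≢j r a , removable-after-addBox pμ i≢j r a)
                 (λ a r → cong G (removeBox-addBox-comm pμ i≢j a r))

    -- Row 0 is always addable and row i+1 is addable exactly when row i is removable.
    addable-count : ∀ x → ∑< n (λ i → when (addable μ i) x) ≡ ∑< n (λ j → when (removable μ j) x) + x
    addable-count x =
      trans (+-comm x _) (cong (_+ x) (sym (∑<-extend _ (n≤1+n (length μ))
                                                λ j≥ → cong (λ b → when b x) (removable-beyond μ j≥))))

    upper-lower-as-∑< : ∑ (∑ G ∘ lower) (upper μ) ≡ ∑< n (λ i → ∑< n (addRemove i))
    upper-lower-as-∑< =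
      trans (∑-upper (∑ G ∘ lower) μ ≤-refl) (∑<-cong n λ {i} _ →
        trans (cong (when (addable μ i)) (∑-lower G (addBox μ i) (length-addBox μ i)))
              (when-∑< (addable μ i) n (addRemove′ i)))
      where
      addRemove′ : ℕ → ℕ → ℕ
      addRemove′ i j = when (removable (addBox μ i) j) (G (removeBox (addBox μ i) j))

    lower-upper-as-∑< : ∑ (∑ G ∘ upper) (lower μ) ≡ ∑< n (λ j → ∑< n (removeAdd j))
    lower-upper-as-∑< =
      trans (∑-lower (∑ G ∘ upper) μ (n≤1+n _)) (∑<-cong n λ {j} _ →
        trans (cong (when (removable μ j)) (∑-upper G (removeBox μ j) (s≤s (length-removeBox μ j))))
              (when-∑< (removable μ j) n (removeAdd′ j)))
      where
      removeAdd′ : ℕ → ℕ → ℕ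
      removeAdd′ j i = when (addable (removeBox μ j) i) (G (addBox (removeBox μ j) i))

  upper-lower-comm : ∑ (∑ G ∘ lower) (upper μ) ≡ ∑ (∑ G ∘ upper) (lower μ) + G μ
  upper-lower-comm = begin
    ∑ (∑ G ∘ lower) (upper μ)
      ≡⟨ upper-lower-as-∑< ⟩
    ∑< n (λ i → ∑< n (addRemove i))
      ≡⟨ ∑<²-split-diagonal n addRemove ⟩
    offDiagonal n addRemove + ∑< n (λ i → addRemove i i)
      ≡⟨ cong₂ _+_ (offDiagonal-transpose n addRemove removeAdd addRemove≡removeAdd)
                   (∑<-cong n (λ {i} _ → addRemove-diagonal i)) ⟩
    offDiagonal n removeAdd + ∑< n (λ i → when (addable μ i) (G μ))
      ≡⟨ cong (offDiagonal n removeAdd +_) (addable-count (G μ)) ⟩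
    offDiagonal n removeAdd + (∑< n (λ j → when (removable μ j) (G μ)) + G μ)
      ≡⟨ +-assoc (offDiagonal n removeAdd) _ (G μ) ⟨
    offDiagonal n removeAdd + ∑< n (λ j → when (removable μ j) (G μ)) + G μ
      ≡⟨ cong (λ d → offDiagonal n removeAdd + d + G μ) (∑<-cong n (λ {j} _ → removeAdd-diagonal j)) ⟨
    offDiagonal n removeAdd + ∑< n (λ j → removeAdd j j) + G μ
      ≡⟨ cong (_+ G μ) (∑<²-split-diagonal n removeAdd) ⟨
    ∑< n (λ j → ∑< n (removeAdd j)) + G μ
      ≡⟨ cong (_+ G μ) lower-upper-as-∑< ⟨
    ∑ (∑ G ∘ upper) (lower μ) + G μ
      ∎
    where open ≡-Reasoning

neighbours : List ℕ → List (List ℕ)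
neighbours μ = upper μ ++ lower μ

module _ {μ : List ℕ} (pμ : IsPartition μ) where

  ∈-neighbours⁻ : ∀ {ν} → ν ∈ neighbours μ → μ ⋖ ν ⊎ ν ⋖ μ
  ∈-neighbours⁻ ν∈ with ∈-++⁻ (upper μ) ν∈
  ... | inj₁ ν∈upper = inj₁ (∈-upper⁻ pμ ν∈upper)
  ... | inj₂ ν∈lower = inj₂ (∈-lower⁻ pμ ν∈lower)

  isPartition-neighbour : ∀ {ν} → ν ∈ neighbours μ → IsPartition ν
  isPartition-neighbour ν∈ with ∈-neighbours⁻ ν∈
  ... | inj₁ μ⋖ν = proj₁ (proj₂ μ⋖ν)
  ... | inj₂ ν⋖μ = proj₁ ν⋖μ

  neighbours-Unique : Unique (neighbours μ)
  neighbours-Unique = Unique.++⁺ (upper-Unique μ) (lower-Unique (proj₂ pμ)) λ (ν∈upper , ν∈lower) →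
    m≢1+n+m (size μ) {1} (trans (proj₂ (proj₂ (proj₂ (∈-lower⁻ pμ ν∈lower))))
                                (cong suc (proj₂ (proj₂ (proj₂ (∈-upper⁻ pμ ν∈upper))))))

∈-neighbours⁺ : ∀ {μ ν} → μ ⋖ ν ⊎ ν ⋖ μ → ν ∈ neighbours μ
∈-neighbours⁺ {μ} (inj₁ μ⋖ν) = ∈-++⁺ˡ (∈-upper⁺ μ⋖ν)
∈-neighbours⁺ {μ} (inj₂ ν⋖μ) = ∈-++⁺ʳ (upper μ) (∈-lower⁺ ν⋖μ)

-- Walks and oscillating tableaux

-- A walk μ ∷ T from μ is recorded by the list T of the partitions it visits after μ.
walks : List ℕ → ℕ → List (List (List ℕ))
walks μ zero    = [] ∷ []
walks μ (suc l) = concatMap (λ ν → map (ν ∷_) (walks ν l)) (neighbours μ)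

endpoint : List ℕ → List (List ℕ) → List ℕ
endpoint μ []      = μ
endpoint μ (ν ∷ T) = endpoint ν T

last-endpoint : ∀ μ T → last (μ ∷ T) ≡ just (endpoint μ T)
last-endpoint μ []      = refl
last-endpoint μ (ν ∷ T) = last-endpoint ν T

∈-walks⁻ : ∀ {μ} l {T} → IsPartition μ → T ∈ walks μ l → length T ≡ l × Steps (μ ∷ T)
∈-walks⁻ zero    pμ (here refl) = refl , steps-[x]
∈-walks⁻ {μ} (suc l) pμ T∈ with find (∈-concatMap⁻ (λ ν → map (ν ∷_) (walks ν l)) {xs = neighbours μ} T∈)
... | ν , ν∈ , T∈ν with map∷⁻ T∈ν
... | T′ , T′∈ , refl =
  let length≡ , steps = ∈-walks⁻ l (isPartition-neighbour pμ ν∈) T′∈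
  in cong suc length≡ , steps-∷ (∈-neighbours⁻ pμ ν∈) steps

∈-walks⁺ : ∀ {μ} l {T} → length T ≡ l → Steps (μ ∷ T) → T ∈ walks μ l
∈-walks⁺ zero    {[]}    _        _                   = here refl
∈-walks⁺ (suc l) {ν ∷ T} length≡ (steps-∷ step steps) =
  ∈-concatMap⁺ (λ ν → map (ν ∷_) (walks ν l))
    (lose (∈-neighbours⁺ step) (∈-map⁺ (ν ∷_) (∈-walks⁺ l (suc-injective length≡) steps)))

walks-Unique : ∀ {μ} l → IsPartition μ → Unique (walks μ l)
walks-Unique zero    pμ = [] ∷ []
walks-Unique (suc l) pμ =
  concatMap-Unique (neighbours-Unique pμ)
    (tabulate λ ν∈ → Unique.map⁺ ∷-injectiveʳ (walks-Unique l (isPartition-neighbour pμ ν∈)))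
    λ ν≢ν′ (T∈ , T∈′) →
      ν≢ν′ (∷-injectiveˡ (trans (sym (proj₂ (proj₂ (map∷⁻ T∈)))) (proj₂ (proj₂ (map∷⁻ T∈′)))))

_≟ᴸ_ : DecidableEquality (List ℕ)
_≟ᴸ_ = ≡-dec _≟_

tableaux : List ℕ → ℕ → List (List (List ℕ))
tableaux λ′ l = map ([] ∷_) (filter (λ T → endpoint [] T ≟ᴸ λ′) (walks [] l))

∈-tableaux⇔ : ∀ {λ′ l T} → T ∈ tableaux λ′ l ⇔ IsOT λ′ l T
∈-tableaux⇔ {λ′} {l} = mk⇔ sound complete
  where
  sound : ∀ {T} → T ∈ tableaux λ′ l → IsOT λ′ l T
  sound T∈ with map∷⁻ T∈
  ... | T , T∈filter , refl =
    let T∈walks , endpoint≡ = ∈-filter⁻ (λ T → endpoint [] T ≟ᴸ λ′) T∈filter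
        length≡ , steps = ∈-walks⁻ l isPartition-[] T∈walks
    in cong suc length≡ , refl , trans (last-endpoint [] T) (cong just endpoint≡) , steps
  complete : ∀ {T} → IsOT λ′ l T → T ∈ tableaux λ′ l
  complete {_ ∷ T} (length≡ , refl , last≡ , steps) =
    ∈-map⁺ ([] ∷_) (∈-filter⁺ (λ T → endpoint [] T ≟ᴸ λ′) (∈-walks⁺ l (suc-injective length≡) steps)
                                (just-injective (trans (sym (last-endpoint [] T)) last≡)))

tableaux-Unique : ∀ λ′ l → Unique (tableaux λ′ l)
tableaux-Unique λ′ l =
  Unique.map⁺ ∷-injectiveʳ (Unique.filter⁺ (λ T → endpoint [] T ≟ᴸ λ′) (walks-Unique l isPartition-[]))

↭-tableaux : ∀ {λ′ l ts} → Unique ts → (∀ T → (T ∈ ts) ⇔ IsOT λ′ l T) → ts ↭ tableaux λ′ l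
↭-tableaux {λ′} {l} ts! ∈ts⇔ =
  ∼bag⇒↭ (unique∧set⇒bag ts! (tableaux-Unique λ′ l) (λ {T} → ⇔.trans (∈ts⇔ T) (⇔.sym ∈-tableaux⇔)))

δ : List ℕ → List ℕ → ℕ
δ λ′ ν = when (does (ν ≟ᴸ λ′)) 1

endpointSum : List ℕ → ℕ → (List ℕ → ℕ) → ℕ
endpointSum μ l F = ∑ (F ∘ endpoint μ) (walks μ l)

weightedEndpointSum : List ℕ → ℕ → (List ℕ → ℕ) → ℕ
weightedEndpointSum μ l F = ∑ (λ T → wt (μ ∷ T) * F (endpoint μ T)) (walks μ l)

∑-tableaux : ∀ (g : List (List ℕ) → ℕ) λ′ l
  → ∑ g (tableaux λ′ l) ≡ ∑ (λ T → when (does (endpoint [] T ≟ᴸ λ′)) (g ([] ∷ T))) (walks [] l)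
∑-tableaux g λ′ l =
  trans (∑-map g ([] ∷_) (filter _ (walks [] l)))
        (∑-filter (λ T → endpoint [] T ≟ᴸ λ′) (g ∘ ([] ∷_)) (walks [] l))

length-tableaux≡endpointSum : ∀ λ′ l → length (tableaux λ′ l) ≡ endpointSum [] l (δ λ′)
length-tableaux≡endpointSum λ′ l = trans (sym (∑-const-1 (tableaux λ′ l))) (∑-tableaux (λ _ → 1) λ′ l)

∑-wt-tableaux≡weightedEndpointSum : ∀ λ′ l → ∑ wt (tableaux λ′ l) ≡ weightedEndpointSum [] l (δ λ′)
∑-wt-tableaux≡weightedEndpointSum λ′ l =
  trans (∑-tableaux wt λ′ l) (∑-cong (walks [] l) (λ T → when-* (does (endpoint [] T ≟ᴸ λ′)) (wt ([] ∷ T))))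

-- The up and down operators

U D U+D N : (List ℕ → ℕ) → List ℕ → ℕ
U F μ = ∑ F (upper μ)
D F μ = ∑ F (lower μ)
U+D F μ = ∑ F (neighbours μ)
N F μ = size μ * F μ

endpointSum-suc : ∀ μ l F → endpointSum μ (suc l) F ≡ ∑ (λ ν → endpointSum ν l F) (neighbours μ)
endpointSum-suc μ l F =
  trans (∑-concatMap (F ∘ endpoint μ) (λ ν → map (ν ∷_) (walks ν l)) (neighbours μ))
        (∑-cong (neighbours μ) (λ ν → ∑-map (F ∘ endpoint μ) (ν ∷_) (walks ν l)))

endpointSum-last : ∀ l μ F → endpointSum μ (suc l) F ≡ endpointSum μ l (U+D F)
endpointSum-last zero    μ F =
  trans (endpointSum-suc μ 0 F) (trans (∑-cong (neighbours μ) (λ ν → +-identityʳ (F ν))) (sym (+-identityʳ _)))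
endpointSum-last (suc l) μ F =
  trans (endpointSum-suc μ (suc l) F)
        (trans (∑-cong (neighbours μ) (λ ν → endpointSum-last l ν F)) (sym (endpointSum-suc μ l (U+D F))))

weightedEndpointSum-suc : ∀ μ l F → weightedEndpointSum μ (suc l) F
  ≡ ∑ (λ ν → size μ * endpointSum ν l F + weightedEndpointSum ν l F) (neighbours μ)
weightedEndpointSum-suc μ l F =
  trans (∑-concatMap summand (λ ν → map (ν ∷_) (walks ν l)) (neighbours μ))
        (∑-cong (neighbours μ) (λ ν → trans (∑-map summand (ν ∷_) (walks ν l)) (first-vertex ν)))
  where
  summand : List (List ℕ) → ℕ
  summand T = wt (μ ∷ T) * F (endpoint μ T)
  first-vertex : ∀ ν → ∑ (summand ∘ (ν ∷_)) (walks ν l) ≡ size μ * endpointSum ν l F + weightedEndpointSum ν l F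
  first-vertex ν = begin
    ∑ (λ T → (size μ + wt (ν ∷ T)) * F (endpoint ν T)) (walks ν l)
      ≡⟨ ∑-cong (walks ν l) (λ T → *-distribʳ-+ (F (endpoint ν T)) (size μ) (wt (ν ∷ T))) ⟩
    ∑ (λ T → size μ * F (endpoint ν T) + wt (ν ∷ T) * F (endpoint ν T)) (walks ν l)
      ≡⟨ ∑-distrib-+ (λ T → size μ * F (endpoint ν T)) (λ T → wt (ν ∷ T) * F (endpoint ν T)) (walks ν l) ⟩
    ∑ (λ T → size μ * F (endpoint ν T)) (walks ν l) + weightedEndpointSum ν l F
      ≡⟨ cong (_+ weightedEndpointSum ν l F) (∑-distribˡ-* (size μ) (F ∘ endpoint ν) (walks ν l)) ⟩
    size μ * endpointSum ν l F + weightedEndpointSum ν l F ∎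
    where open ≡-Reasoning

weightedEndpointSum-last : ∀ l μ F
  → weightedEndpointSum μ (suc l) F ≡ weightedEndpointSum μ l (U+D F) + endpointSum μ (suc l) (N F)
weightedEndpointSum-last zero μ F = begin
  weightedEndpointSum μ 1 F
    ≡⟨ weightedEndpointSum-suc μ 0 F ⟩
  ∑ (λ ν → size μ * (F ν + 0) + ((size ν + 0) * F ν + 0)) (neighbours μ)
    ≡⟨ ∑-cong (neighbours μ) (λ ν → cong₂ _+_ (cong (size μ *_) (+-identityʳ (F ν)))
                                             (trans (+-identityʳ _) (cong (_* F ν) (+-identityʳ (size ν))))) ⟩
  ∑ (λ ν → size μ * F ν + size ν * F ν) (neighbours μ)
    ≡⟨ ∑-distrib-+ (λ ν → size μ * F ν) (N F) (neighbours μ) ⟩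
  ∑ (λ ν → size μ * F ν) (neighbours μ) + ∑ (N F) (neighbours μ)
    ≡⟨ cong₂ _+_ (trans (∑-distribˡ-* (size μ) F (neighbours μ))
                        (sym (trans (+-identityʳ _) (cong (_* U+D F μ) (+-identityʳ (size μ))))))
                 (sym (trans (endpointSum-suc μ 0 (N F)) (∑-cong (neighbours μ) (λ ν → +-identityʳ (N F ν))))) ⟩
  weightedEndpointSum μ 0 (U+D F) + endpointSum μ 1 (N F) ∎
  where open ≡-Reasoning
weightedEndpointSum-last (suc l) μ F = begin
  weightedEndpointSum μ (2 + l) F
    ≡⟨ weightedEndpointSum-suc μ (suc l) F ⟩
  ∑ (λ ν → size μ * endpointSum ν (suc l) F + weightedEndpointSum ν (suc l) F) (neighbours μ)
    ≡⟨ ∑-cong (neighbours μ) (λ ν → cong₂ _+_ (cong (size μ *_) (endpointSum-last l ν F))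
                                             (weightedEndpointSum-last l ν F)) ⟩
  ∑ (λ ν → size μ * S ν + (W ν + S′ ν)) (neighbours μ)
    ≡⟨ ∑-cong (neighbours μ) (λ ν → sym (+-assoc (size μ * S ν) (W ν) (S′ ν))) ⟩
  ∑ (λ ν → (size μ * S ν + W ν) + S′ ν) (neighbours μ)
    ≡⟨ ∑-distrib-+ (λ ν → size μ * S ν + W ν) S′ (neighbours μ) ⟩
  ∑ (λ ν → size μ * S ν + W ν) (neighbours μ) + ∑ S′ (neighbours μ)
    ≡⟨ cong₂ _+_ (sym (weightedEndpointSum-suc μ l (U+D F))) (sym (endpointSum-suc μ (suc l) (N F))) ⟩
  weightedEndpointSum μ (suc l) (U+D F) + endpointSum μ (2 + l) (N F)
    ∎
  where
  open ≡-Reasoning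
  S W S′ : List ℕ → ℕ
  S  ν = endpointSum ν l (U+D F)
  W  ν = weightedEndpointSum ν l (U+D F)
  S′ ν = endpointSum ν (suc l) (N F)

U^ : ℕ → (List ℕ → ℕ) → List ℕ → ℕ
U^ zero    F = F
U^ (suc h) F = U^ h (U F)

_≈_ : (F G : List ℕ → ℕ) → Set
F ≈ G = ∀ {μ} → IsPartition μ → F μ ≡ G μ

U-cong : ∀ {F G} → F ≈ G → U F ≈ U G
U-cong F≈G pμ = ∑-cong-∈ _ (λ ν∈ → F≈G (proj₁ (proj₂ (∈-upper⁻ pμ ν∈))))

U^-cong : ∀ h {F G} → F ≈ G → U^ h F ≈ U^ h G
U^-cong zero    F≈G = F≈G
U^-cong (suc h) F≈G = U^-cong h (U-cong F≈G)

U^-distrib-+ : ∀ h F G → U^ h (λ ν → F ν + G ν) ≈ (λ ν → U^ h F ν + U^ h G ν)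
U^-distrib-+ zero    F G pμ = refl
U^-distrib-+ (suc h) F G pμ =
  trans (U^-cong h (λ {ν} _ → ∑-distrib-+ F G (upper ν)) pμ) (U^-distrib-+ h (U F) (U G) pμ)

U^-D : ∀ h G → U^ h (D G) ≈ (λ μ → D (U^ h G) μ + h * U^ (pred h) G μ)
U^-D zero    G pμ = sym (+-identityʳ _)
U^-D (suc h) G {μ} pμ = begin
  U^ h (U (D G)) μ                   ≡⟨ U^-cong h (λ pν → upper-lower-comm pν G) pμ ⟩
  U^ h (λ ν → D (U G) ν + G ν) μ     ≡⟨ U^-distrib-+ h (D (U G)) G pμ ⟩
  U^ h (D (U G)) μ + U^ h G μ        ≡⟨ cong (_+ U^ h G μ) (U^-D h (U G) pμ) ⟩
  d + h * U^ (pred h) (U G) μ + x    ≡⟨ cong (λ y → d + y + x) (pred-U h) ⟩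
  d + h * x + x                      ≡⟨ +-assoc d (h * x) x ⟩
  d + (h * x + x)                    ≡⟨ cong (d +_) (+-comm (h * x) x) ⟩
  d + suc h * x                      ∎
  where
  open ≡-Reasoning
  d = D (U^ (suc h) G) μ
  x = U^ h G μ
  pred-U : ∀ h → h * U^ (pred h) (U G) μ ≡ h * U^ h G μ
  pred-U zero    = refl
  pred-U (suc h) = refl

U^-N : ∀ h F → U^ h (N F) ≈ (λ μ → (size μ + h) * U^ h F μ)
U^-N zero    F {μ} pμ = cong (_* F μ) (sym (+-identityʳ (size μ)))
U^-N (suc h) F {μ} pμ = begin
  U^ h (U (N F)) μ                            ≡⟨ U^-cong h U-N pμ ⟩
  U^ h (λ ν → U F ν + N (U F) ν) μ            ≡⟨ U^-distrib-+ h (U F) (N (U F)) pμ ⟩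
  U^ h (U F) μ + U^ h (N (U F)) μ             ≡⟨ cong (U^ h (U F) μ +_) (U^-N h (U F) pμ) ⟩
  U^ h (U F) μ + (size μ + h) * U^ h (U F) μ  ≡⟨ cong (_* U^ h (U F) μ) (+-suc (size μ) h) ⟨
  (size μ + suc h) * U^ (suc h) F μ           ∎
  where
  open ≡-Reasoning
  U-N : U (N F) ≈ (λ ν → U F ν + N (U F) ν)
  U-N {ν} pν =
    trans (∑-cong-∈ {g = λ ρ → suc (size ν) * F ρ} (upper ν)
                    (λ {ρ} ρ∈ → cong (_* F ρ) (proj₂ (proj₂ (proj₂ (∈-upper⁻ pν ρ∈))))))
          (∑-distribˡ-* (suc (size ν)) F (upper ν))

U^-vanish : ∀ h F {μ} → IsPartition μ → (∀ {ν} → IsPartition ν → size ν ≡ size μ + h → F ν ≡ 0)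
  → U^ h F μ ≡ 0
U^-vanish zero    F pμ F≡0 = F≡0 pμ (sym (+-identityʳ _))
U^-vanish (suc h) F {μ} pμ F≡0 = U^-vanish h (U F) pμ λ {ν} pν size≡ →
  trans (∑-cong-∈ (upper ν) (λ ρ∈ → let pν , pρ , _ , size-ρ = ∈-upper⁻ pν ρ∈ in
                                     F≡0 pρ (trans size-ρ (trans (cong suc size≡) (sym (+-suc (size μ) h))))))
        (∑-zero (upper ν))

E : (List ℕ → ℕ) → ℕ → ℕ
E F h = U^ h F []

E-D : ∀ G h → E (D G) h ≡ h * E G (pred h)
E-D G h = U^-D h G isPartition-[]

E-U+D : ∀ G h → E (U+D G) h ≡ E G (suc h) + h * E G (pred h)
E-U+D G h = trans (U^-cong h (λ {ν} _ → ∑-++ G (upper ν) (lower ν)) isPartition-[])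
                (trans (U^-distrib-+ h (U G) (D G) isPartition-[]) (cong (E G (suc h) +_) (E-D G h)))

E-N : ∀ G h → E (N G) h ≡ h * E G h
E-N G h = U^-N h G isPartition-[]

E-δ : ∀ λ′ {h} → h ≢ size λ′ → E (δ λ′) h ≡ 0
E-δ λ′ h≢ = U^-vanish _ (δ λ′) isPartition-[] δ≡0
  where
  δ≡0 : ∀ {ν} → IsPartition ν → size ν ≡ _ → δ λ′ ν ≡ 0
  δ≡0 {ν} _ size≡h with ν ≟ᴸ λ′
  ... | yes refl = ⊥-elim (h≢ (sym size≡h))
  ... | no _     = refl

-- Partial matchings

extend : (ℕ → ℕ) → ℕ → ℕ
extend c zero    = c 1
extend c (suc h) = c h + suc (suc h) * c (suc (suc h))

-- matchings l h counts the partial matchings of l points in a row with h unmatched points, built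
-- from left to right: each new point is left open or matched to one of the open points before it.
-- weightedMatchings l h adds up, over all of these, the number of open points after each step.
matchings : ℕ → ℕ → ℕ
matchings zero    zero    = 1
matchings zero    (suc h) = 0
matchings (suc l) h       = extend (matchings l) h

weightedMatchings : ℕ → ℕ → ℕ
weightedMatchings zero    h = 0
weightedMatchings (suc l) h = extend (weightedMatchings l) h + h * matchings (suc l) h

matchings-vanish : ∀ {l h} → l < h → matchings l h ≡ 0
matchings-vanish {zero}  {suc h} _         = refl
matchings-vanish {suc l} {suc h} (s≤s l<h) =
  trans (cong₂ (λ x y → x + suc (suc h) * y) (matchings-vanish l<h) (matchings-vanish (≤-trans l<h (m≤n+m h 2))))
        (*-zeroʳ (suc (suc h)))

weightedMatchings-vanish : ∀ {l h} → l < h → weightedMatchings l h ≡ 0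
weightedMatchings-vanish {zero}  {h}     _         = refl
weightedMatchings-vanish {suc l} {suc h} (s≤s l<h) =
  trans (cong₃ (weightedMatchings-vanish l<h) (weightedMatchings-vanish (≤-trans l<h (m≤n+m h 2)))
               (matchings-vanish {suc l} {suc h} (s≤s l<h)))
        (cong₂ _+_ (*-zeroʳ (suc (suc h))) (*-zeroʳ (suc h)))
  where
  cong₃ : ∀ {x x′ y y′ z z′} → x ≡ x′ → y ≡ y′ → z ≡ z′
    → x + suc (suc h) * y + suc h * z ≡ x′ + suc (suc h) * y′ + suc h * z′
  cong₃ refl refl refl = refl

matchings-closed : ∀ l h n → l ≡ h + 2 * n → matchings l h * (h ! * (2 ^ n * n !)) ≡ l !
matchings-closed zero    zero    zero    _ = refl
matchings-closed (suc l) zero    (suc m) e = begin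
  matchings l 1 * (1 * (2 * 2 ^ m * (suc m * m !)))
    ≡⟨ regroup (matchings l 1) (2 ^ m) (m !) m ⟩
  (2 + 2 * m) * (matchings l 1 * (1 ! * (2 ^ m * m !)))
    ≡⟨ cong₂ _*_ (sym l+1≡) (matchings-closed l 1 m (suc-injective l+1≡)) ⟩
  suc l * l !
    ∎
  where
  open ≡-Reasoning
  l+1≡ : suc l ≡ 2 + 2 * m
  l+1≡ = trans e (cong suc (+-suc m (m + 0)))
  regroup : ∀ x p f m → x * (1 * (2 * p * (suc m * f))) ≡ (2 + 2 * m) * (x * (1 * (p * f)))
  regroup = solve-∀
matchings-closed (suc l) (suc g) zero    e with refl ← trans (suc-injective e) (+-identityʳ g) = begin
  (matchings l l + suc (suc l) * matchings l (suc (suc l))) * (suc l ! * 1)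
    ≡⟨ cong (λ y → (matchings l l + suc (suc l) * y) * (suc l ! * 1))
            (matchings-vanish (≤-trans (n<1+n l) (n≤1+n _))) ⟩
  (matchings l l + suc (suc l) * 0) * (suc l * l ! * 1)
    ≡⟨ regroup (matchings l l) l (l !) ⟩
  suc l * (matchings l l * (l ! * (2 ^ 0 * 0 !)))
    ≡⟨ cong (suc l *_) (matchings-closed l l 0 (sym (+-identityʳ l))) ⟩
  suc l * l !
    ∎
  where
  open ≡-Reasoning
  regroup : ∀ x l f → (x + suc (suc l) * 0) * (suc l * f * 1) ≡ suc l * (x * (f * 1))
  regroup = solve-∀
matchings-closed (suc l) (suc g) (suc m) e with refl ← suc-injective e = begin
  (x + suc (suc g) * y) * (suc g * g ! * (2 * 2 ^ m * (suc m * m !)))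
    ≡⟨ regroup x y g m (g !) (2 ^ m) (m !) ⟩
  suc g * (x * (g ! * (2 ^ suc m * suc m !))) + (2 + 2 * m) * (y * (suc (suc g) ! * (2 ^ m * m !)))
    ≡⟨ cong₂ (λ a b → suc g * a + (2 + 2 * m) * b)
             (matchings-closed l g (suc m) refl) (matchings-closed l (2 + g) m (shift g m)) ⟩
  suc g * l ! + (2 + 2 * m) * l !
    ≡⟨ *-distribʳ-+ (l !) (suc g) (2 + 2 * m) ⟨
  (suc g + (2 + 2 * m)) * l !
    ≡⟨ cong (_* l !) (sum≡ g m) ⟩
  suc l * l !
    ∎
  where
  open ≡-Reasoning
  x = matchings l g
  y = matchings l (2 + g)
  shift : ∀ g m → g + 2 * suc m ≡ 2 + g + 2 * m
  shift = solve-∀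
  sum≡ : ∀ g m → suc g + (2 + 2 * m) ≡ suc (g + 2 * suc m)
  sum≡ = solve-∀
  regroup : ∀ x y g m f p q → (x + suc (suc g) * y) * (suc g * f * (2 * p * (suc m * q)))
    ≡ suc g * (x * (f * (2 * p * (suc m * q)))) + (2 + 2 * m) * (y * (suc (suc g) * (suc g * f) * (p * q)))
  regroup = solve-∀

weightedMatchings-closed : ∀ l h n → l ≡ h + 2 * n
  → 6 * weightedMatchings l h * (h ! * (2 ^ n * n !)) ≡ l ! * ((2 * n + h + 1) * (2 * n + 3 * h))
weightedMatchings-closed zero    zero    zero    _ = refl
weightedMatchings-closed (suc l) zero    (suc m) e = begin
  6 * (w + 0 * matchings (suc l) 0) * (1 * (2 * 2 ^ m * (suc m * m !)))
    ≡⟨ regroup w (matchings (suc l) 0) (2 ^ m) (m !) m ⟩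
  (2 + 2 * m) * (6 * w * (1 ! * (2 ^ m * m !)))
    ≡⟨ cong ((2 + 2 * m) *_) (weightedMatchings-closed l 1 m (suc-injective l+1≡)) ⟩
  (2 + 2 * m) * (l ! * ((2 * m + 1 + 1) * (2 * m + 3 * 1)))
    ≡⟨ expand (l !) m ⟩
  (2 + 2 * m) * l ! * ((2 * suc m + 0 + 1) * (2 * suc m + 3 * 0))
    ≡⟨ cong (λ n → n * l ! * ((2 * suc m + 0 + 1) * (2 * suc m + 3 * 0))) l+1≡ ⟨
  suc l * l ! * ((2 * suc m + 0 + 1) * (2 * suc m + 3 * 0))
    ∎
  where
  open ≡-Reasoning
  w = weightedMatchings l 1
  l+1≡ : suc l ≡ 2 + 2 * m
  l+1≡ = trans e (cong suc (+-suc m (m + 0)))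
  regroup : ∀ w x p q m → 6 * (w + 0 * x) * (1 * (2 * p * (suc m * q))) ≡ (2 + 2 * m) * (6 * w * (1 * 1 * (p * q)))
  regroup = solve-∀
  expand : ∀ f m → (2 + 2 * m) * (f * ((2 * m + 1 + 1) * (2 * m + 3 * 1)))
    ≡ (2 + 2 * m) * f * ((2 * suc m + 0 + 1) * (2 * suc m + 3 * 0))
  expand = solve-∀
weightedMatchings-closed (suc l) (suc g) zero    e with refl ← trans (suc-injective e) (+-identityʳ g) = begin
  6 * (w + suc (suc l) * weightedMatchings l (suc (suc l)) + suc l * x) * (suc l ! * 1)
    ≡⟨ cong (λ y → 6 * (w + suc (suc l) * y + suc l * x) * (suc l ! * 1))
            (weightedMatchings-vanish (≤-trans (n<1+n l) (n≤1+n _))) ⟩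
  6 * (w + suc (suc l) * 0 + suc l * x) * (suc l * l ! * 1)
    ≡⟨ regroup w x l (l !) ⟩
  suc l * (6 * w * (l ! * (2 ^ 0 * 0 !))) + 6 * suc l * (x * (suc l ! * (2 ^ 0 * 0 !)))
    ≡⟨ cong₂ (λ y z → suc l * y + 6 * suc l * z) (weightedMatchings-closed l l 0 (sym (+-identityʳ l)))
                                                 (matchings-closed (suc l) (suc l) 0 (cong suc (sym (+-identityʳ l)))) ⟩
  suc l * (l ! * ((2 * 0 + l + 1) * (2 * 0 + 3 * l))) + 6 * suc l * (suc l * l !)
    ≡⟨ expand l (l !) ⟩
  suc l * l ! * ((2 * 0 + suc l + 1) * (2 * 0 + 3 * suc l))
    ∎
  where
  open ≡-Reasoning
  w = weightedMatchings l l
  x = matchings (suc l) (suc l)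
  regroup : ∀ w x l f → 6 * (w + suc (suc l) * 0 + suc l * x) * (suc l * f * 1)
    ≡ suc l * (6 * w * (f * (1 * 1))) + 6 * suc l * (x * (suc l * f * (1 * 1)))
  regroup = solve-∀
  expand : ∀ l f → suc l * (f * ((2 * 0 + l + 1) * (2 * 0 + 3 * l))) + 6 * suc l * (suc l * f)
    ≡ suc l * f * ((2 * 0 + suc l + 1) * (2 * 0 + 3 * suc l))
  expand = solve-∀
weightedMatchings-closed (suc l) (suc g) (suc m) e with refl ← suc-injective e = begin
  6 * (w + suc (suc g) * w′ + suc g * x) * (suc g * g ! * (2 * 2 ^ m * (suc m * m !)))
    ≡⟨ regroup w w′ x g m (g !) (2 ^ m) (m !) ⟩
  suc g * (6 * w * (g ! * (2 ^ suc m * suc m !))) + (2 + 2 * m) * (6 * w′ * (suc (suc g) ! * (2 ^ m * m !)))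
    + 6 * suc g * (x * (suc g ! * (2 ^ suc m * suc m !)))
    ≡⟨ cong₃ (weightedMatchings-closed l g (suc m) refl) (weightedMatchings-closed l (2 + g) m (shift g m))
             (matchings-closed (suc l) (suc g) (suc m) refl) ⟩
  suc g * (l ! * ((2 * suc m + g + 1) * (2 * suc m + 3 * g)))
    + (2 + 2 * m) * (l ! * ((2 * m + (2 + g) + 1) * (2 * m + 3 * (2 + g)))) + 6 * suc g * (suc l * l !)
    ≡⟨ expand g m (l !) ⟩
  suc l * l ! * ((2 * suc m + suc g + 1) * (2 * suc m + 3 * suc g))
    ∎
  where
  open ≡-Reasoning
  w  = weightedMatchings l g
  w′ = weightedMatchings l (2 + g)
  x  = matchings (suc l) (suc g)
  shift : ∀ g m → g + 2 * suc m ≡ 2 + g + 2 * m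
  shift = solve-∀
  cong₃ : ∀ {a a′ b b′ c c′ : ℕ} → a ≡ a′ → b ≡ b′ → c ≡ c′
    → suc g * a + (2 + 2 * m) * b + 6 * suc g * c ≡ suc g * a′ + (2 + 2 * m) * b′ + 6 * suc g * c′
  cong₃ refl refl refl = refl
  regroup : ∀ w w′ x g m f p q → 6 * (w + suc (suc g) * w′ + suc g * x) * (suc g * f * (2 * p * (suc m * q)))
    ≡ suc g * (6 * w * (f * (2 * p * (suc m * q)))) + (2 + 2 * m) * (6 * w′ * (suc (suc g) * (suc g * f) * (p * q)))
      + 6 * suc g * (x * (suc g * f * (2 * p * (suc m * q))))
  regroup = solve-∀
  expand : ∀ g m f → suc g * (f * ((2 * suc m + g + 1) * (2 * suc m + 3 * g)))
    + (2 + 2 * m) * (f * ((2 * m + (2 + g) + 1) * (2 * m + 3 * (2 + g)))) + 6 * suc g * (suc (g + 2 * suc m) * f)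
    ≡ suc (g + 2 * suc m) * f * ((2 * suc m + suc g + 1) * (2 * suc m + 3 * suc g))
  expand = solve-∀

weightedMatchings≡ : ∀ h n
  → 6 * weightedMatchings (h + 2 * n) h ≡ matchings (h + 2 * n) h * ((2 * n + h + 1) * (2 * n + 3 * h))
weightedMatchings≡ h n = *-cancelʳ-≡ _ _ (h ! * (2 ^ n * n !)) ⦃ nonZero ⦄ (begin
  6 * weightedMatchings l h * (h ! * (2 ^ n * n !))          ≡⟨ weightedMatchings-closed l h n refl ⟩
  l ! * X                                                    ≡⟨ cong (_* X) (matchings-closed l h n refl) ⟨
  matchings l h * (h ! * (2 ^ n * n !)) * X                  ≡⟨ *.xy∙z≈xz∙y (matchings l h) (h ! * (2 ^ n * n !)) X ⟩
  matchings l h * X * (h ! * (2 ^ n * n !))                  ∎)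
  where
  open ≡-Reasoning
  l = h + 2 * n
  X = (2 * n + h + 1) * (2 * n + 3 * h)
  nonZero = m*n≢0 (h !) (2 ^ n * n !) ⦃ h !≢0 ⦄ ⦃ m*n≢0 (2 ^ n) (n !) ⦃ m^n≢0 2 n ⦄ ⦃ n !≢0 ⦄ ⦄

extend-transpose : ∀ l (c e : ℕ → ℕ) → (∀ {h} → l < h → c h ≡ 0)
  → ∑< (suc l) (λ h → c h * (e (suc h) + h * e (pred h))) ≡ ∑< (2 + l) (λ h → extend c h * e h)
extend-transpose l c e c≡0 = begin
  ∑< (suc l) (λ h → c h * (e (suc h) + h * e (pred h)))
    ≡⟨ ∑<-cong (suc l) (λ {h} _ → *-distribˡ-+ (c h) (e (suc h)) (h * e (pred h))) ⟩
  ∑< (suc l) (λ h → raised h + c h * (h * e (pred h)))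
    ≡⟨ ∑<-distrib-+ (suc l) raised (λ h → c h * (h * e (pred h))) ⟩
  ∑< (suc l) raised + ∑< (suc l) (λ h → c h * (h * e (pred h)))
    ≡⟨ cong (∑< (suc l) raised +_) lowering ⟩
  ∑< (suc l) raised + (c 1 * e 0 + ∑< (suc l) lowered)
    ≡⟨ +.x∙yz≈y∙xz (∑< (suc l) raised) (c 1 * e 0) _ ⟩
  c 1 * e 0 + (∑< (suc l) raised + ∑< (suc l) lowered)
    ≡⟨ cong (c 1 * e 0 +_) (∑<-distrib-+ (suc l) raised lowered) ⟨
  c 1 * e 0 + ∑< (suc l) (λ h → raised h + lowered h)
    ≡⟨ cong (c 1 * e 0 +_) (∑<-cong (suc l) (λ {h} _ →
         *-distribʳ-+ (e (suc h)) (c h) (suc (suc h) * c (suc (suc h))))) ⟨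
  ∑< (2 + l) (λ h → extend c h * e h)
    ∎
  where
  open ≡-Reasoning
  raised lowered : ℕ → ℕ
  raised  h = c h * e (suc h)
  lowered h = suc (suc h) * c (suc (suc h)) * e (suc h)
  reindex : ∀ h c e → c * (suc (suc h) * e) ≡ suc (suc h) * c * e
  reindex = solve-∀
  lowering : ∑< (suc l) (λ h → c h * (h * e (pred h))) ≡ c 1 * e 0 + ∑< (suc l) lowered
  lowering = begin
    c 0 * 0 + ∑< l (λ h → c (suc h) * (suc h * e h))
      ≡⟨ cong (_+ ∑< l (λ h → c (suc h) * (suc h * e h))) (*-zeroʳ (c 0)) ⟩
    ∑< l (λ h → c (suc h) * (suc h * e h))
      ≡⟨ ∑<-extend (λ h → c (suc h) * (suc h * e h)) (m≤n+m l 2)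
                   (λ {h} l≤h → cong (_* (suc h * e h)) (c≡0 (s≤s l≤h))) ⟨
    c 1 * (1 * e 0) + ∑< (suc l) (λ h → c (suc (suc h)) * (suc (suc h) * e (suc h)))
      ≡⟨ cong₂ _+_ (cong (c 1 *_) (*-identityˡ (e 0)))
                   (∑<-cong (suc l) (λ {h} _ → reindex h (c (suc (suc h))) (e (suc h)))) ⟩
    c 1 * e 0 + ∑< (suc l) lowered
      ∎

-- Expanding the walk sums from ∅

endpointSum-[] : ∀ l F → endpointSum [] l F ≡ ∑< (suc l) (λ h → matchings l h * E F h)
endpointSum-[] zero    F = cong (_+ 0) (sym (*-identityˡ (F [])))
endpointSum-[] (suc l) F = begin
  endpointSum [] (suc l) F                                   ≡⟨ endpointSum-last l [] F ⟩
  endpointSum [] l (U+D F)                                   ≡⟨ endpointSum-[] l (U+D F) ⟩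
  ∑< (suc l) (λ h → a h * E (U+D F) h)                       ≡⟨ ∑<-cong (suc l) (λ {h} _ → cong (a h *_) (E-U+D F h)) ⟩
  ∑< (suc l) (λ h → a h * (E F (suc h) + h * E F (pred h)))  ≡⟨ extend-transpose l a (E F) matchings-vanish ⟩
  ∑< (2 + l) (λ h → matchings (suc l) h * E F h)             ∎
  where
  open ≡-Reasoning
  a = matchings l

weightedEndpointSum-[] : ∀ l F → weightedEndpointSum [] l F ≡ ∑< (suc l) (λ h → weightedMatchings l h * E F h)
weightedEndpointSum-[] zero    F = refl
weightedEndpointSum-[] (suc l) F = begin
  weightedEndpointSum [] (suc l) F
    ≡⟨ weightedEndpointSum-last l [] F ⟩
  weightedEndpointSum [] l (U+D F) + endpointSum [] (suc l) (N F)
    ≡⟨ cong₂ _+_ (weightedEndpointSum-[] l (U+D F)) (endpointSum-[] (suc l) (N F)) ⟩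
  ∑< (suc l) (λ h → w h * E (U+D F) h) + ∑< (2 + l) (λ h → a h * E (N F) h)
    ≡⟨ cong₂ _+_ (∑<-cong (suc l) (λ {h} _ → cong (w h *_) (E-U+D F h)))
                 (∑<-cong (2 + l) (λ {h} _ → cong (a h *_) (E-N F h))) ⟩
  ∑< (suc l) (λ h → w h * (E F (suc h) + h * E F (pred h))) + ∑< (2 + l) (λ h → a h * (h * E F h))
    ≡⟨ cong (_+ ∑< (2 + l) (λ h → a h * (h * E F h))) (extend-transpose l w (E F) weightedMatchings-vanish) ⟩
  ∑< (2 + l) (λ h → extend w h * E F h) + ∑< (2 + l) (λ h → a h * (h * E F h))
    ≡⟨ ∑<-distrib-+ (2 + l) (λ h → extend w h * E F h) (λ h → a h * (h * E F h)) ⟨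
  ∑< (2 + l) (λ h → extend w h * E F h + a h * (h * E F h))
    ≡⟨ ∑<-cong (2 + l) (λ {h} _ → collect (extend w h) (a h) h (E F h)) ⟩
  ∑< (2 + l) (λ h → weightedMatchings (suc l) h * E F h)
    ∎
  where
  open ≡-Reasoning
  w = weightedMatchings l
  a = matchings (suc l)
  collect : ∀ x y h e → x * e + y * (h * e) ≡ (x + h * y) * e
  collect = solve-∀

∑<-E-δ : ∀ λ′ {l} → size λ′ ≤ l → (c : ℕ → ℕ)
  → ∑< (suc l) (λ h → c h * E (δ λ′) h) ≡ c (size λ′) * E (δ λ′) (size λ′)
∑<-E-δ λ′ k≤l c =
  ∑<-pick (size λ′) (λ h → c h * E (δ λ′) h) (s≤s k≤l) (λ {h} h≢k → trans (cong (c h *_) (E-δ λ′ h≢k)) (*-zeroʳ (c h)))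

length-tableaux : ∀ λ′ {l} → size λ′ ≤ l
  → length (tableaux λ′ l) ≡ matchings l (size λ′) * E (δ λ′) (size λ′)
length-tableaux λ′ {l} k≤l =
  trans (length-tableaux≡endpointSum λ′ l)
        (trans (endpointSum-[] l (δ λ′)) (∑<-E-δ λ′ k≤l (matchings l)))

∑-wt-tableaux : ∀ λ′ {l} → size λ′ ≤ l
  → ∑ wt (tableaux λ′ l) ≡ weightedMatchings l (size λ′) * E (δ λ′) (size λ′)
∑-wt-tableaux λ′ {l} k≤l =
  trans (∑-wt-tableaux≡weightedEndpointSum λ′ l)
        (trans (weightedEndpointSum-[] l (δ λ′)) (∑<-E-δ λ′ k≤l (weightedMatchings l)))

corollary3 : (λ′ : List ℕ) → IsPartition λ′ → (n : ℕ)
    → (ts : List (List (List ℕ))) → Unique ts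
    → (∀ T → (T ∈ ts) ⇔ IsOT λ′ (size λ′ + 2 * n) T)
    → 6 * sum (map wt ts)
      ≡ length ts * (2 * n + size λ′ + 1) * (2 * n + 3 * size λ′)
corollary3 λ′ _ n ts ts! ∈ts⇔ = begin
  6 * sum (map wt ts)              ≡⟨ cong (6 *_) (sum-↭ (↭.map⁺ wt ts↭)) ⟩
  6 * ∑ wt (tableaux λ′ l)         ≡⟨ cong (6 *_) (∑-wt-tableaux λ′ k≤l) ⟩
  6 * (weightedMatchings l k * f)  ≡⟨ *-assoc 6 (weightedMatchings l k) f ⟨
  6 * weightedMatchings l k * f    ≡⟨ cong (_* f) (weightedMatchings≡ k n) ⟩
  matchings l k * X * f            ≡⟨ *.xy∙z≈xz∙y (matchings l k) X f ⟩
  matchings l k * f * X            ≡⟨ cong (_* X) (trans (↭.↭-length ts↭) (length-tableaux λ′ k≤l)) ⟨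
  length ts * X                    ≡⟨ *-assoc (length ts) _ _ ⟨
  length ts * (2 * n + k + 1) * (2 * n + 3 * k) ∎
  where
  open ≡-Reasoning
  k = size λ′
  l = k + 2 * n
  f = E (δ λ′) k
  X = (2 * n + k + 1) * (2 * n + 3 * k)
  k≤l = m≤m+n k (2 * n)
  ts↭ = ↭-tableaux ts! ∈ts⇔
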